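{- Let $(G,c)$ be a bicolored graph with vertex set $[n]$ such that $1,2,\dots,n$ is a successful pressing sequence, let $A=A(G)$, and let $A=LL^T$ with $L$ an invertible lower-triangular matrix over $\mathbb{F}_2$. Let $\sigma$ be a permutation of $[n]$ and $P$ the permutation matrix encoding $\sigma$, so that $(PAP^T)_{i,j}=A_{\sigma(i),\sigma(j)}$. Then $\sigma(1),\dots,\sigma(n)$ is a successful pressing sequence of $(G,c)$ if and only if there exist an orthogonal matrix $Q$ and an upper-triangular matrix $U$ over $\mathbb{F}_2$ such that $L^TP^T=QU$.
   Context: A bicolored graph is a pair $(G,c)$ with $G$ a finite simple graph and $c:V(G)\to\{\text{black},\text{white}\}$. The augmented adjacency matrix $A(G)\in\mathbb{F}_2^{n\times n}$ is the adjacency matrix of $G$ with diagonal entry $1$ at black and $0$ at white vertices. Pressing a black vertex $v$ complements the induced subgraph on the closed neighborhood $N^\ast(v)=N(v)\cup\{v\}$ and flips the color of each vertex of $N^\ast(v)$, leaving everything else unchanged. A pressing sequence is a sequence of vertices each black at the moment it is pressed; it is successful if the final graph has no edges and all vertices white. A matrix $Q$ over $\mathbb{F}_2$ is orthogonal if $Q^TQ=I$. -}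

module Defs where

open import Data.Nat using (ℕ; zero; suc; _<_)
open import Data.Bool using (Bool; true; false; _xor_; _∧_; _∨_; not; if_then_else_)
open import Data.Fin using (Fin; zero; suc; toℕ; _≟_)
open import Data.Fin.Permutation using (Permutation′; _⟨$⟩ʳ_)
open import Data.List using (List; []; _∷_; map)
open import Data.List using () renaming (allFin to allFinL)
open import Data.Product using (_×_; Σ; ∃-syntax; _,_)
open import Relation.Binary.PropositionalEquality using (_≡_)
open import Relation.Nullary.Decidable using (⌊_⌋)

-- Scalars in F₂ are Bool: addition = _xor_, multiplication = _∧_.
-- Colors: true = black, false = white.

record BiGraph (n : ℕ) : Set where
  field
    adj   : Fin n → Fin n → Bool
    color : Fin n → Bool
open BiGraph public

IsSimple : ∀ {n} → BiGraph n → Set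
IsSimple g = (∀ i j → adj g i j ≡ adj g j i) × (∀ i → adj g i i ≡ false)

_==_ : ∀ {n} → Fin n → Fin n → Bool
i == j = ⌊ i ≟ j ⌋

inN* : ∀ {n} → BiGraph n → Fin n → Fin n → Bool
inN* g v u = (u == v) ∨ adj g v u

press : ∀ {n} → BiGraph n → Fin n → BiGraph n
adj   (press g v) u w =
  adj g u w xor (inN* g v u ∧ inN* g v w ∧ not (u == w))
color (press g v) u = color g u xor inN* g v u

Successful : ∀ {n} → BiGraph n → List (Fin n) → Set
Successful g [] = (∀ i j → adj g i j ≡ false) × (∀ i → color g i ≡ false)
Successful g (v ∷ vs) = (color g v ≡ true) × Successful (press g v) vs

Mat : ℕ → Set
Mat n = Fin n → Fin n → Bool

sumF : ∀ {n} → (Fin n → Bool) → Bool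
sumF {zero}  f = false
sumF {suc n} f = f zero xor sumF (λ i → f (suc i))

_⊗_ : ∀ {n} → Mat n → Mat n → Mat n
(M ⊗ N) i j = sumF (λ k → M i k ∧ N k j)

_ᵀ : ∀ {n} → Mat n → Mat n
(M ᵀ) i j = M j i

I : ∀ {n} → Mat n
I i j = i == j

_≐_ : ∀ {n} → Mat n → Mat n → Set
M ≐ N = ∀ i j → M i j ≡ N i j

augAdj : ∀ {n} → BiGraph n → Mat n
augAdj g i j = if i == j then color g i else adj g i j

IsLowerTriangular : ∀ {n} → Mat n → Set
IsLowerTriangular M = ∀ i j → toℕ i < toℕ j → M i j ≡ false

IsUpperTriangular : ∀ {n} → Mat n → Set
IsUpperTriangular M = ∀ i j → toℕ j < toℕ i → M i j ≡ false

IsInvertible : ∀ {n} → Mat n → Set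
IsInvertible {n} M = ∃[ N ] ((M ⊗ N) ≐ I × (N ⊗ M) ≐ I)

IsOrthogonal : ∀ {n} → Mat n → Set
IsOrthogonal Q = ((Q ᵀ) ⊗ Q) ≐ I

-- permutation matrix of σ: P i j = 1 iff σ(i) = j, so (P A Pᵀ)ᵢⱼ = A_{σ i, σ j}
permMat : ∀ {n} → Permutation′ n → Mat n
permMat σ i j = (σ ⟨$⟩ʳ i) == j

-- the sequence 1,…,n  (here 0,…,n-1 in Fin n)
idSeq : (n : ℕ) → List (Fin n)
idSeq n = allFinL n

permSeq : ∀ {n} → Permutation′ n → List (Fin n)
permSeq {n} σ = map (σ ⟨$⟩ʳ_) (allFinL n)

module Submission where

-- Write A = A(G), X = Lᵀ Pᵀ and A_σ for the symmetrically permuted matrix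
-- (A_σ)ᵢⱼ = A_{σ i, σ j}.  The proof runs through two independent criteria.
--
-- Pressing a black vertex v acts on A as the symmetric
--    elimination step  A ↦ A + (row v)ᵀ(row v)  with pivot A_vv = 1.  Hence a
--    sequence is successful iff the eliminations along it reduce A to 0, and
--    peeling off one pivot row at a time shows this happens along σ exactly
--    when A_σ = M Mᵀ for a lower-triangular M with unit diagonal (a "unit
--    Cholesky factorisation").
--  * Matrix side.  For any invertible X: X = QU with Q orthogonal and U upper
--    triangular iff XᵀX has a unit Cholesky factorisation (take M = Uᵀ, resp.
--    Q = X (Mᵀ)⁻¹; unit lower-triangular matrices are invertible).
--
-- Since A = L Lᵀ gives A_σ = XᵀX with X = LᵀPᵀ invertible, the theorem is the
-- composite of the two equivalences.

open import Defs
open import Data.Nat using (ℕ; zero; suc; _<_; s≤s; z≤n)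
open import Data.Bool using (Bool; true; false; _xor_; _∧_; not; if_then_else_)
open import Data.Bool.Properties
  using (∧-comm; ∧-assoc; ∧-idem; ∧-identityʳ; ∧-zeroʳ; ∧-distribˡ-xor;
         xor-same; xor-identityʳ; xor-∧-commutativeRing; ∧-commutativeMonoid)
open import Data.Fin using (Fin; zero; suc; toℕ; _≟_)
open import Data.Fin.Properties using (suc-injective)
open import Data.Fin.Permutation using (Permutation′; _⟨$⟩ʳ_; _⟨$⟩ˡ_; inverseˡ; inverseʳ)
open import Data.List using (List; []; _∷_; tabulate)
open import Data.List.Properties using (map-tabulate)
open import Data.Empty using (⊥-elim)
open import Data.Product using (_×_; _,_; proj₁; Σ-syntax; ∃-syntax)
open import Function using (_∘_; id)
open import Function.Bundles using (_⇔_; mk⇔; Equivalence)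
open import Function.Properties.Equivalence using () renaming (trans to ⇔-trans; sym to ⇔-sym)
open import Relation.Nullary using (yes; no; ¬_)
open import Relation.Binary.PropositionalEquality
open import Relation.Binary.Bundles using (Setoid)
open import Level using (0ℓ)
open import Algebra.Bundles using (CommutativeRing; CommutativeMonoid)
open import Algebra.Properties.CommutativeSemigroup
  (CommutativeRing.+-commutativeSemigroup xor-∧-commutativeRing) using (interchange)
open import Algebra.Properties.CommutativeSemigroup
  (CommutativeMonoid.commutativeSemigroup ∧-commutativeMonoid) using (x∙yz≈y∙xz)
import Relation.Binary.Reasoning.Setoid as SetoidReasoning

xor-cancel : ∀ a b → a xor (b xor a) ≡ b
xor-cancel false b = xor-identityʳ b
xor-cancel true false = refl
xor-cancel true true = refl

xor-cancelʳ : ∀ a b → (a xor b) xor a ≡ b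
xor-cancelʳ false b = xor-identityʳ b
xor-cancelʳ true false = refl
xor-cancelʳ true true = refl

==-refl : ∀ {n} (i : Fin n) → (i == i) ≡ true
==-refl i with i ≟ i
... | yes _ = refl
... | no i≢i = ⊥-elim (i≢i refl)

==-≢ : ∀ {n} {i j : Fin n} → ¬ (i ≡ j) → (i == j) ≡ false
==-≢ {i = i} {j} i≢j with i ≟ j
... | yes i≡j = ⊥-elim (i≢j i≡j)
... | no _ = refl

==-sym : ∀ {n} (i j : Fin n) → (i == j) ≡ (j == i)
==-sym i j with i ≟ j | j ≟ i
... | yes _ | yes _ = refl
... | no _ | no _ = refl
... | yes p | no q = ⊥-elim (q (sym p))
... | no p | yes q = ⊥-elim (p (sym q))

==-injective : ∀ {m n} (f : Fin m → Fin n) → (∀ {i j} → f i ≡ f j → i ≡ j)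
  → ∀ i j → (f i == f j) ≡ (i == j)
==-injective f inj i j with i ≟ j
... | yes refl = ==-refl (f i)
... | no i≢j = ==-≢ (i≢j ∘ inj)

==-suc : ∀ {n} (i j : Fin n) → (suc i == suc j) ≡ (i == j)
==-suc = ==-injective suc suc-injective

sumF-cong : ∀ {n} {f g : Fin n → Bool} → (∀ k → f k ≡ g k) → sumF f ≡ sumF g
sumF-cong {zero} e = refl
sumF-cong {suc n} e = cong₂ _xor_ (e zero) (sumF-cong (e ∘ suc))

sumF-zero : ∀ {n} {f : Fin n → Bool} → (∀ k → f k ≡ false) → sumF f ≡ false
sumF-zero {zero} e = refl
sumF-zero {suc n} e rewrite e zero = sumF-zero (e ∘ suc)

sumF-xor : ∀ {n} (f g : Fin n → Bool) → sumF (λ k → f k xor g k) ≡ sumF f xor sumF g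
sumF-xor {zero} f g = refl
sumF-xor {suc n} f g =
  trans (cong ((f zero xor g zero) xor_) (sumF-xor (f ∘ suc) (g ∘ suc)))
        (interchange (f zero) (g zero) _ _)

sumF-∧ˡ : ∀ {n} a (f : Fin n → Bool) → a ∧ sumF f ≡ sumF (λ k → a ∧ f k)
sumF-∧ˡ {zero} a f = ∧-zeroʳ a
sumF-∧ˡ {suc n} a f =
  trans (∧-distribˡ-xor a (f zero) _) (cong ((a ∧ f zero) xor_) (sumF-∧ˡ a (f ∘ suc)))

sumF-∧ʳ : ∀ {n} a (f : Fin n → Bool) → sumF f ∧ a ≡ sumF (λ k → f k ∧ a)
sumF-∧ʳ a f = trans (∧-comm _ a) (trans (sumF-∧ˡ a f) (sumF-cong (λ k → ∧-comm a (f k))))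

sumF-swap : ∀ {m n} (f : Fin m → Fin n → Bool) →
  sumF (λ i → sumF (f i)) ≡ sumF (λ j → sumF (λ i → f i j))
sumF-swap {zero} {n} f = sym (sumF-zero {n} (λ _ → refl))
sumF-swap {suc m} f =
  trans (cong (sumF (f zero) xor_) (sumF-swap (f ∘ suc)))
        (sym (sumF-xor (f zero) (λ j → sumF (λ i → f (suc i) j))))

sumF-single : ∀ {n} (f : Fin n → Bool) (i : Fin n) → (∀ k → ¬ (k ≡ i) → f k ≡ false)
  → sumF f ≡ f i
sumF-single {suc n} f zero e
  rewrite sumF-zero {f = f ∘ suc} (λ k → e (suc k) (λ ())) = xor-identityʳ (f zero)
sumF-single {suc n} f (suc i) e rewrite e zero (λ ()) =
  sumF-single (f ∘ suc) i (λ k k≢i → e (suc k) (k≢i ∘ suc-injective))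

≐-setoid : ℕ → Setoid 0ℓ 0ℓ
≐-setoid n = record
  { Carrier = Mat n ; _≈_ = _≐_
  ; isEquivalence = record
    { refl = λ _ _ → refl
    ; sym = λ e i j → sym (e i j)
    ; trans = λ e f i j → trans (e i j) (f i j) } }

module ≐-Reasoning {n : ℕ} = SetoidReasoning (≐-setoid n)
open ≐-Reasoning using (begin_; _∎; step-≈-⟩; step-≈-⟨)

≐-refl : ∀ {n} {A : Mat n} → A ≐ A
≐-refl _ _ = refl

≐-sym : ∀ {n} {A B : Mat n} → A ≐ B → B ≐ A
≐-sym e i j = sym (e i j)

⊗-cong : ∀ {n} {A A′ B B′ : Mat n} → A ≐ A′ → B ≐ B′ → (A ⊗ B) ≐ (A′ ⊗ B′)
⊗-cong eA eB i j = sumF-cong (λ k → cong₂ _∧_ (eA i k) (eB k j))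

⊗-congˡ : ∀ {n} {A B B′ : Mat n} → B ≐ B′ → (A ⊗ B) ≐ (A ⊗ B′)
⊗-congˡ = ⊗-cong ≐-refl

⊗-congʳ : ∀ {n} {A A′ B : Mat n} → A ≐ A′ → (A ⊗ B) ≐ (A′ ⊗ B)
⊗-congʳ e = ⊗-cong e ≐-refl

ᵀ-cong : ∀ {n} {A A′ : Mat n} → A ≐ A′ → (A ᵀ) ≐ (A′ ᵀ)
ᵀ-cong e i j = e j i

⊗-assoc : ∀ {n} (A B C : Mat n) → ((A ⊗ B) ⊗ C) ≐ (A ⊗ (B ⊗ C))
⊗-assoc A B C i j =
  trans (sumF-cong (λ k → trans (sumF-∧ʳ (C k j) (λ l → A i l ∧ B l k))
                                (sumF-cong (λ l → ∧-assoc (A i l) (B l k) (C k j)))))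
  (trans (sumF-swap (λ k l → A i l ∧ (B l k ∧ C k j)))
         (sumF-cong (λ l → sym (sumF-∧ˡ (A i l) (λ k → B l k ∧ C k j)))))

ᵀ-⊗ : ∀ {n} (A B : Mat n) → ((A ⊗ B) ᵀ) ≐ ((B ᵀ) ⊗ (A ᵀ))
ᵀ-⊗ A B i j = sumF-cong (λ k → ∧-comm (A j k) (B k i))

I-⊗ : ∀ {n} (A : Mat n) → (I ⊗ A) ≐ A
I-⊗ A i j =
  trans (sumF-single _ i (λ k k≢i → cong (_∧ A k j) (==-≢ (k≢i ∘ sym))))
        (cong (_∧ A i j) (==-refl i))

⊗-I : ∀ {n} (A : Mat n) → (A ⊗ I) ≐ A
⊗-I A i j =
  trans (sumF-single _ j (λ k k≢j → trans (cong (A i k ∧_) (==-≢ k≢j)) (∧-zeroʳ (A i k))))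
        (trans (cong (A i j ∧_) (==-refl j)) (∧-identityʳ (A i j)))

Iᵀ : ∀ {n} → ((I {n}) ᵀ) ≐ I
Iᵀ i j = ==-sym j i

inverse-ᵀ : ∀ {n} (M N : Mat n) → (M ⊗ N) ≐ I → ((N ᵀ) ⊗ (M ᵀ)) ≐ I
inverse-ᵀ M N MN = begin
  (N ᵀ) ⊗ (M ᵀ)  ≈⟨ ᵀ-⊗ M N ⟨
  (M ⊗ N) ᵀ      ≈⟨ ᵀ-cong MN ⟩
  I ᵀ            ≈⟨ Iᵀ ⟩
  I              ∎

gram-⊗ : ∀ {n} (A B : Mat n) → (((A ⊗ B) ᵀ) ⊗ (A ⊗ B)) ≐ ((B ᵀ) ⊗ (((A ᵀ) ⊗ A) ⊗ B))
gram-⊗ A B = begin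
  ((A ⊗ B) ᵀ) ⊗ (A ⊗ B)            ≈⟨ ⊗-congʳ (ᵀ-⊗ A B) ⟩
  ((B ᵀ) ⊗ (A ᵀ)) ⊗ (A ⊗ B)        ≈⟨ ⊗-assoc (B ᵀ) (A ᵀ) _ ⟩
  (B ᵀ) ⊗ ((A ᵀ) ⊗ (A ⊗ B))        ≈⟨ ⊗-congˡ (⊗-assoc (A ᵀ) A B) ⟨
  (B ᵀ) ⊗ (((A ᵀ) ⊗ A) ⊗ B)        ∎

ᵀ-invertible : ∀ {n} {M : Mat n} → IsInvertible M → IsInvertible (M ᵀ)
ᵀ-invertible {M = M} (N , MN , NM) = N ᵀ , inverse-ᵀ N M NM , inverse-ᵀ M N MN

⊗-invertible : ∀ {n} {M M′ : Mat n} → IsInvertible M → IsInvertible M′ → IsInvertible (M ⊗ M′)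
⊗-invertible {M = M} {M′} (N , MN , NM) (N′ , MN′ , NM′) = N′ ⊗ N , cancel M M′ N′ N MN′ MN , cancel N′ N M M′ NM NM′
  where
  cancel : ∀ A B C D → (B ⊗ C) ≐ I → (A ⊗ D) ≐ I → ((A ⊗ B) ⊗ (C ⊗ D)) ≐ I
  cancel A B C D BC AD = begin
    (A ⊗ B) ⊗ (C ⊗ D)    ≈⟨ ⊗-assoc A B _ ⟩
    A ⊗ (B ⊗ (C ⊗ D))    ≈⟨ ⊗-congˡ (⊗-assoc B C D) ⟨
    A ⊗ ((B ⊗ C) ⊗ D)    ≈⟨ ⊗-congˡ (⊗-congʳ BC) ⟩
    A ⊗ (I ⊗ D)          ≈⟨ ⊗-congˡ (I-⊗ D) ⟩
    A ⊗ D                ≈⟨ AD ⟩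
    I                    ∎

module _ {n : ℕ} (σ : Permutation′ n) where

  private
    P : Mat n
    P = permMat σ

  permMat-⊗ : ∀ (Y : Mat n) i j → (P ⊗ Y) i j ≡ Y (σ ⟨$⟩ʳ i) j
  permMat-⊗ Y i j =
    trans (sumF-single _ (σ ⟨$⟩ʳ i) (λ k k≢σi → cong (_∧ Y k j) (==-≢ (k≢σi ∘ sym))))
          (cong (_∧ Y (σ ⟨$⟩ʳ i) j) (==-refl _))

  permMatᵀ-⊗ : ∀ (Y : Mat n) i j → ((P ᵀ) ⊗ Y) i j ≡ Y (σ ⟨$⟩ˡ i) j
  permMatᵀ-⊗ Y i j =
    trans (sumF-single _ (σ ⟨$⟩ˡ i)
            (λ k k≢ → cong (_∧ Y k j) (==-≢ (λ σk≡i → k≢ (trans (sym (inverseˡ σ)) (cong (σ ⟨$⟩ˡ_) σk≡i))))))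
          (cong (_∧ Y (σ ⟨$⟩ˡ i) j) (trans (cong (_== i) (inverseʳ σ)) (==-refl i)))

  ⊗-permMatᵀ : ∀ (Y : Mat n) i j → (Y ⊗ (P ᵀ)) i j ≡ Y i (σ ⟨$⟩ʳ j)
  ⊗-permMatᵀ Y i j =
    trans (sumF-single _ (σ ⟨$⟩ʳ j)
            (λ k k≢σj → trans (cong (Y i k ∧_) (==-≢ (k≢σj ∘ sym))) (∧-zeroʳ _)))
          (trans (cong (Y i (σ ⟨$⟩ʳ j) ∧_) (==-refl _)) (∧-identityʳ _))

  permMat-invertible : IsInvertible P
  permMat-invertible = P ᵀ , PPᵀ , PᵀP
    where
    σ-injective : ∀ {i j} → σ ⟨$⟩ʳ i ≡ σ ⟨$⟩ʳ j → i ≡ j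
    σ-injective {i} {j} p = trans (sym (inverseˡ σ)) (trans (cong (σ ⟨$⟩ˡ_) p) (inverseˡ σ))
    PPᵀ : (P ⊗ (P ᵀ)) ≐ I
    PPᵀ i j = trans (permMat-⊗ (P ᵀ) i j)
                    (trans (==-injective (σ ⟨$⟩ʳ_) σ-injective j i) (==-sym j i))
    PᵀP : ((P ᵀ) ⊗ P) ≐ I
    PᵀP i j = trans (permMatᵀ-⊗ P i j) (cong (_== j) (inverseʳ σ))

IsUnitLowerTriangular : ∀ {n} → Mat n → Set
IsUnitLowerTriangular M = IsLowerTriangular M × (∀ i → M i i ≡ true)

trailing : ∀ {n} → Mat (suc n) → Mat n
trailing M i j = M (suc i) (suc j)

trailing-lower : ∀ {n} (M : Mat (suc n)) → IsLowerTriangular M → IsLowerTriangular (trailing M)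
trailing-lower M lower i j i<j = lower (suc i) (suc j) (s≤s i<j)

-- A lower-triangular matrix with a right inverse has unit diagonal:
-- M₀₀ Y₀₀ = 1 forces M₀₀ = 1, then Y₀ⱼ = 0 for j > 0, and the trailing blocks
-- of M and Y are again inverse to each other.
unit-diagonal : ∀ {n} (M Y : Mat n) → IsLowerTriangular M → (M ⊗ Y) ≐ I → ∀ i → M i i ≡ true
unit-diagonal {suc n} M Y lower MY = diagonal
  where
  tail-zero : ∀ j → sumF (λ k → M zero (suc k) ∧ Y (suc k) j) ≡ false
  tail-zero j = sumF-zero (λ k → cong (_∧ Y (suc k) j) (lower zero (suc k) (s≤s z≤n)))
  row₀ : ∀ j → M zero zero ∧ Y zero j ≡ (zero == j)
  row₀ j = trans (sym (trans (cong ((M zero zero ∧ Y zero j) xor_) (tail-zero j)) (xor-identityʳ _)))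
                 (MY zero j)
  M₀₀ : M zero zero ≡ true
  M₀₀ with M zero zero | row₀ zero
  ... | true | _ = refl
  ... | false | ()
  Y₀ⱼ : ∀ j → Y zero (suc j) ≡ false
  Y₀ⱼ j = trans (cong (_∧ Y zero (suc j)) (sym M₀₀)) (row₀ (suc j))
  trailing-inverse : (trailing M ⊗ trailing Y) ≐ I
  trailing-inverse i j =
    trans (sym (cong (_xor (trailing M ⊗ trailing Y) i j)
                     (trans (cong (M (suc i) zero ∧_) (Y₀ⱼ j)) (∧-zeroʳ _))))
          (trans (MY (suc i) (suc j)) (==-suc i j))
  diagonal : ∀ i → M i i ≡ true
  diagonal zero = M₀₀
  diagonal (suc i) = unit-diagonal (trailing M) (trailing Y) (trailing-lower M lower) trailing-inverse i

-- A unit lower-triangular matrix has a left inverse, built block by block: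
-- for M = [1 0; c M′] and K′ M′ = I take K = [1 0; K′c K′].
left-inverse : ∀ {n} (M : Mat n) → IsUnitLowerTriangular M → ∃[ K ] ((K ⊗ M) ≐ I)
left-inverse {zero} M _ = (λ ()) , (λ ())
left-inverse {suc n} M (lower , diag)
  with left-inverse (trailing M) (trailing-lower M lower , diag ∘ suc)
... | K′ , K′M′ = K , KM
  where
  K′c : Fin n → Bool
  K′c i = sumF (λ k → K′ i k ∧ M (suc k) zero)
  K : Mat (suc n)
  K zero zero = true
  K zero (suc j) = false
  K (suc i) zero = K′c i
  K (suc i) (suc j) = K′ i j
  KM : (K ⊗ M) ≐ I
  KM zero zero rewrite diag zero = cong (true xor_) (sumF-zero {n} (λ k → refl))
  KM zero (suc j) rewrite lower zero (suc j) (s≤s z≤n) = sumF-zero {n} (λ k → refl)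
  KM (suc i) zero rewrite diag zero | ∧-identityʳ (K′c i) = xor-same (K′c i)
  KM (suc i) (suc j) rewrite lower zero (suc j) (s≤s z≤n) | ∧-zeroʳ (K′c i) =
    trans (K′M′ i j) (sym (==-suc i j))

HasQR : ∀ {n} → Mat n → Set
HasQR X = ∃[ Q ] ∃[ U ] (IsOrthogonal Q × IsUpperTriangular U × X ≐ (Q ⊗ U))

HasUnitCholesky : ∀ {n} → Mat n → Set
HasUnitCholesky B = ∃[ M ] (IsUnitLowerTriangular M × B ≐ (M ⊗ (M ᵀ)))

unitCholesky-cong : ∀ {n} {B B′ : Mat n} → B ≐ B′ → HasUnitCholesky B ⇔ HasUnitCholesky B′
unitCholesky-cong {n} B≐B′ = mk⇔ (transport B≐B′) (transport (≐-sym B≐B′))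
  where
  transport : ∀ {C C′ : Mat n} → C ≐ C′ → HasUnitCholesky C → HasUnitCholesky C′
  transport C≐C′ (M , unit , C≐MMᵀ) = M , unit , (λ i j → trans (sym (C≐C′ i j)) (C≐MMᵀ i j))

-- X = QU gives XᵀX = Uᵀ(QᵀQ)U = UᵀU; and if X is invertible so is U, which
-- forces the lower-triangular Uᵀ to have unit diagonal.
qr⇒unitCholesky : ∀ {n} {X : Mat n} → IsInvertible X → HasQR X → HasUnitCholesky ((X ᵀ) ⊗ X)
qr⇒unitCholesky {n} {X} (Y , _ , YX) (Q , U , QᵀQ , upper , X≐QU) =
  U ᵀ , (Uᵀ-lower , unit-diagonal (U ᵀ) (W ᵀ) Uᵀ-lower (inverse-ᵀ W U WU)) , gram
  where
  Uᵀ-lower : IsLowerTriangular (U ᵀ)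
  Uᵀ-lower i j i<j = upper j i i<j
  gram : ((X ᵀ) ⊗ X) ≐ ((U ᵀ) ⊗ U)
  gram = begin
    (X ᵀ) ⊗ X                    ≈⟨ ⊗-cong (ᵀ-cong X≐QU) X≐QU ⟩
    ((Q ⊗ U) ᵀ) ⊗ (Q ⊗ U)        ≈⟨ gram-⊗ Q U ⟩
    (U ᵀ) ⊗ (((Q ᵀ) ⊗ Q) ⊗ U)    ≈⟨ ⊗-congˡ (⊗-congʳ QᵀQ) ⟩
    (U ᵀ) ⊗ (I ⊗ U)              ≈⟨ ⊗-congˡ (I-⊗ U) ⟩
    (U ᵀ) ⊗ U                    ∎
  W : Mat n
  W = Y ⊗ Q
  WU : (W ⊗ U) ≐ I
  WU = begin
    (Y ⊗ Q) ⊗ U    ≈⟨ ⊗-assoc Y Q U ⟩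
    Y ⊗ (Q ⊗ U)    ≈⟨ ⊗-congˡ X≐QU ⟨
    Y ⊗ X          ≈⟨ YX ⟩
    I              ∎

-- Conversely, from XᵀX = MMᵀ put Q = (Xᵀ)⁻¹ M.  Then QMᵀ = (Xᵀ)⁻¹XᵀX = X,
-- so Q = X(Mᵀ)⁻¹ and QᵀQ = M⁻¹(XᵀX)(Mᵀ)⁻¹ = I.
unitCholesky⇒qr : ∀ {n} {X : Mat n} → IsInvertible X → HasUnitCholesky ((X ᵀ) ⊗ X) → HasQR X
unitCholesky⇒qr {n} {X} (Y , XY , _) (M , unit@(lower , _) , XᵀX≐MMᵀ)
  with left-inverse M unit
... | K , KM = Q , M ᵀ , QᵀQ , (λ i j j<i → lower j i j<i) , ≐-sym QMᵀ
  where
  Q : Mat n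
  Q = (Y ᵀ) ⊗ M
  QMᵀ : (Q ⊗ (M ᵀ)) ≐ X
  QMᵀ = begin
    ((Y ᵀ) ⊗ M) ⊗ (M ᵀ)    ≈⟨ ⊗-assoc (Y ᵀ) M (M ᵀ) ⟩
    (Y ᵀ) ⊗ (M ⊗ (M ᵀ))    ≈⟨ ⊗-congˡ XᵀX≐MMᵀ ⟨
    (Y ᵀ) ⊗ ((X ᵀ) ⊗ X)    ≈⟨ ⊗-assoc (Y ᵀ) (X ᵀ) X ⟨
    ((Y ᵀ) ⊗ (X ᵀ)) ⊗ X    ≈⟨ ⊗-congʳ (inverse-ᵀ X Y XY) ⟩
    I ⊗ X                  ≈⟨ I-⊗ X ⟩
    X                      ∎
  Q≐XKᵀ : Q ≐ (X ⊗ (K ᵀ))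
  Q≐XKᵀ = begin
    Q                          ≈⟨ ⊗-I Q ⟨
    Q ⊗ I                      ≈⟨ ⊗-congˡ (inverse-ᵀ K M KM) ⟨
    Q ⊗ ((M ᵀ) ⊗ (K ᵀ))        ≈⟨ ⊗-assoc Q (M ᵀ) (K ᵀ) ⟨
    (Q ⊗ (M ᵀ)) ⊗ (K ᵀ)        ≈⟨ ⊗-congʳ QMᵀ ⟩
    X ⊗ (K ᵀ)                  ∎
  QᵀQ : IsOrthogonal Q
  QᵀQ = begin
    (Q ᵀ) ⊗ Q                              ≈⟨ ⊗-cong (ᵀ-cong Q≐XKᵀ) Q≐XKᵀ ⟩
    ((X ⊗ (K ᵀ)) ᵀ) ⊗ (X ⊗ (K ᵀ))          ≈⟨ gram-⊗ X (K ᵀ) ⟩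
    K ⊗ (((X ᵀ) ⊗ X) ⊗ (K ᵀ))              ≈⟨ ⊗-congˡ (⊗-congʳ XᵀX≐MMᵀ) ⟩
    K ⊗ ((M ⊗ (M ᵀ)) ⊗ (K ᵀ))              ≈⟨ ⊗-congˡ (⊗-assoc M (M ᵀ) (K ᵀ)) ⟩
    K ⊗ (M ⊗ ((M ᵀ) ⊗ (K ᵀ)))              ≈⟨ ⊗-assoc K M _ ⟨
    (K ⊗ M) ⊗ ((M ᵀ) ⊗ (K ᵀ))              ≈⟨ ⊗-cong KM (inverse-ᵀ K M KM) ⟩
    I ⊗ I                                  ≈⟨ I-⊗ I ⟩
    I                                      ∎

qr⇔unitCholesky : ∀ {n} {X : Mat n} → IsInvertible X → HasQR X ⇔ HasUnitCholesky ((X ᵀ) ⊗ X)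
qr⇔unitCholesky X-inv = mk⇔ (qr⇒unitCholesky X-inv) (unitCholesky⇒qr X-inv)

IsSymmetric : ∀ {n} → Mat n → Set
IsSymmetric A = ∀ i j → A i j ≡ A j i

eliminate : ∀ {n} → Mat n → Fin n → Mat n
eliminate A v u w = A u w xor (A v u ∧ A v w)

eliminate-symmetric : ∀ {n} (A : Mat n) v → IsSymmetric A → IsSymmetric (eliminate A v)
eliminate-symmetric A v A-sym u w = cong₂ _xor_ (A-sym u w) (∧-comm (A v u) (A v w))

Eliminates : ∀ {n} → Mat n → List (Fin n) → Set
Eliminates A [] = ∀ i j → A i j ≡ false
Eliminates A (v ∷ vs) = (A v v ≡ true) × Eliminates (eliminate A v) vs

eliminates-cong : ∀ {n} (vs : List (Fin n)) {A B : Mat n} → A ≐ B → Eliminates A vs → Eliminates B vs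
eliminates-cong [] A≐B A≐0 i j = trans (sym (A≐B i j)) (A≐0 i j)
eliminates-cong (v ∷ vs) A≐B (pivot , rest) =
  trans (sym (A≐B v v)) pivot ,
  eliminates-cong vs (λ u w → cong₂ _xor_ (A≐B u w) (cong₂ _∧_ (A≐B v u) (A≐B v w))) rest

augAdj-symmetric : ∀ {n} (g : BiGraph n) → IsSimple g → IsSymmetric (augAdj g)
augAdj-symmetric g (adj-sym , _) i j with i ≟ j | j ≟ i
... | yes refl | yes _ = refl
... | yes p | no q = ⊥-elim (q (sym p))
... | no p | yes q = ⊥-elim (p (sym q))
... | no _ | no _ = adj-sym i j

augAdj-diagonal : ∀ {n} (g : BiGraph n) i → augAdj g i i ≡ color g i
augAdj-diagonal g i = cong (λ b → if b then color g i else adj g i i) (==-refl i)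

press-simple : ∀ {n} (g : BiGraph n) v → IsSimple g → IsSimple (press g v)
press-simple g v (adj-sym , loopless) =
  (λ u w → cong₂ _xor_ (adj-sym u w)
     (trans (x∙yz≈y∙xz (inN* g v u) (inN* g v w) _)
            (cong (λ b → inN* g v w ∧ (inN* g v u ∧ not b)) (==-sym u w)))) ,
  (λ u → trans (cong₂ (λ a b → a xor (inN* g v u ∧ inN* g v u ∧ not b)) (loopless u) (==-refl u))
               (no-loop (inN* g v u)))
  where
  no-loop : ∀ x → false xor (x ∧ x ∧ false) ≡ false
  no-loop false = refl
  no-loop true = refl

augAdj-row : ∀ {n} (g : BiGraph n) v u → color g v ≡ true → augAdj g v u ≡ inN* g v u
augAdj-row g v u black with v ≟ u | u ≟ v
... | yes refl | yes _ = black
... | yes p | no q = ⊥-elim (q (sym p))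
... | no p | yes q = ⊥-elim (p (sym q))
... | no _ | no _ = refl

press-augAdj : ∀ {n} (g : BiGraph n) v → color g v ≡ true
  → augAdj (press g v) ≐ eliminate (augAdj g) v
press-augAdj g v black u w rewrite augAdj-row g v u black | augAdj-row g v w black with u ≟ w
... | yes refl = cong (color g u xor_) (sym (∧-idem (inN* g v u)))
... | no _ = cong (adj g u w xor_) (cong (inN* g v u ∧_) (∧-identityʳ (inN* g v w)))

successful⇔eliminates : ∀ {n} (g : BiGraph n) → IsSimple g → (vs : List (Fin n))
  → Successful g vs ⇔ Eliminates (augAdj g) vs
successful⇔eliminates g (_ , loopless) [] = mk⇔ to from
  where
  to : Successful g [] → Eliminates (augAdj g) []
  to (no-edges , all-white) i j with i ≟ j
  ... | yes refl = all-white i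
  ... | no _ = no-edges i j
  from : Eliminates (augAdj g) [] → Successful g []
  from A≐0 = no-edges , (λ i → trans (sym (augAdj-diagonal g i)) (A≐0 i i))
    where
    no-edges : ∀ i j → adj g i j ≡ false
    no-edges i j with i ≟ j | A≐0 i j
    ... | yes refl | _ = loopless i
    ... | no _ | e = e
successful⇔eliminates g simple (v ∷ vs) = mk⇔ to from
  where
  rest : ∀ black → Successful (press g v) vs ⇔ Eliminates (eliminate (augAdj g) v) vs
  rest black = ⇔-trans (successful⇔eliminates (press g v) (press-simple g v simple) vs)
    (mk⇔ (eliminates-cong vs (press-augAdj g v black))
         (eliminates-cong vs (≐-sym (press-augAdj g v black))))
  to : Successful g (v ∷ vs) → Eliminates (augAdj g) (v ∷ vs)
  to (black , s) = trans (augAdj-diagonal g v) black , Equivalence.to (rest black) s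
  from : Eliminates (augAdj g) (v ∷ vs) → Successful g (v ∷ vs)
  from (pivot , e) = black , Equivalence.from (rest black) e
    where
    black : color g v ≡ true
    black = trans (sym (augAdj-diagonal g v)) pivot

-- A = Σₖ (row k)ᵀ(row k), where row k has a 1 at pivot f(k) and vanishes at
-- all earlier pivots.  (Row k is row f(k) of A after k eliminations.)
record PivotFactorisation {m n} (f : Fin m → Fin n) (A : Mat n) : Set where
  field
    row     : Fin m → Fin n → Bool
    pivot   : ∀ k → row k (f k) ≡ true
    echelon : ∀ k l → toℕ k < toℕ l → row l (f k) ≡ false
    gram    : ∀ u w → A u w ≡ sumF (λ k → row k u ∧ row k w)
open PivotFactorisation

-- Columns of A that vanish also vanish in every row of the factorisation;
-- this invariant is what makes later rows vanish at earlier pivots.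
KeepsZeroColumns : ∀ {m n} → Mat n → (Fin m → Fin n → Bool) → Set
KeepsZeroColumns A R = ∀ x → (∀ u → A u x ≡ false) → ∀ k → R k x ≡ false

-- Successful elimination yields the factorisation: the first row is row f(0)
-- of A, the rest factorise the eliminated matrix, whose column f(0) is zero.
eliminates⇒factorisation : ∀ {m n} (f : Fin m → Fin n) (A : Mat n) → IsSymmetric A
  → Eliminates A (tabulate f) → Σ[ F ∈ PivotFactorisation f A ] KeepsZeroColumns A (row F)
eliminates⇒factorisation {zero} f A _ A≐0 =
  record { row = λ (); pivot = λ (); echelon = λ (); gram = A≐0 } , λ _ _ ()
eliminates⇒factorisation {suc m} {n} f A A-sym (pivot₀ , rest)
  with eliminates⇒factorisation (f ∘ suc) (eliminate A (f zero))
         (eliminate-symmetric A (f zero) A-sym) rest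
... | F′ , keeps′ = F , keeps
  where
  v : Fin n
  v = f zero
  R : Fin (suc m) → Fin n → Bool
  R zero = A v
  R (suc k) = row F′ k
  column-v-cleared : ∀ u → eliminate A v u v ≡ false
  column-v-cleared u rewrite pivot₀ | ∧-identityʳ (A v u) | A-sym v u = xor-same (A u v)
  echelon-R : ∀ k l → toℕ k < toℕ l → R l (f k) ≡ false
  echelon-R zero (suc l) _ = keeps′ v column-v-cleared l
  echelon-R (suc k) (suc l) (s≤s k<l) = echelon F′ k l k<l
  F : PivotFactorisation f A
  F = record
    { row = R
    ; pivot = λ { zero → pivot₀ ; (suc k) → pivot F′ k }
    ; echelon = echelon-R
    ; gram = λ u w → trans (sym (xor-cancel (A v u ∧ A v w) (A u w)))
                           (cong ((A v u ∧ A v w) xor_) (gram F′ u w)) }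
  keeps : KeepsZeroColumns A R
  keeps x zero-col zero = zero-col v
  keeps x zero-col (suc k) = keeps′ x still-zero k
    where
    still-zero : ∀ u → eliminate A v u x ≡ false
    still-zero u rewrite zero-col u | zero-col v | ∧-zeroʳ (A v u) = refl

-- Conversely, such a factorisation makes every pivot 1, and eliminating the
-- first pivot removes exactly the first term of the sum.
factorisation⇒eliminates : ∀ {m n} (f : Fin m → Fin n) (A : Mat n)
  → PivotFactorisation f A → Eliminates A (tabulate f)
factorisation⇒eliminates {zero} f A F = gram F
factorisation⇒eliminates {suc m} {n} f A F = pivot-is-one ,
  factorisation⇒eliminates (f ∘ suc) (eliminate A v) F′
  where
  v : Fin n
  v = f zero
  later : Fin n → Fin n → Bool
  later u w = sumF (λ k → row F (suc k) u ∧ row F (suc k) w)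
  later-at-v : ∀ u → later v u ≡ false
  later-at-v u = sumF-zero (λ k → cong (_∧ row F (suc k) u) (echelon F zero (suc k) (s≤s z≤n)))
  row-v : ∀ u → A v u ≡ row F zero u
  row-v u rewrite gram F v u | later-at-v u | pivot F zero = xor-identityʳ (row F zero u)
  pivot-is-one : A v v ≡ true
  pivot-is-one = trans (row-v v) (pivot F zero)
  F′ : PivotFactorisation (f ∘ suc) (eliminate A v)
  F′ = record
    { row = row F ∘ suc
    ; pivot = pivot F ∘ suc
    ; echelon = λ k l k<l → echelon F (suc k) (suc l) (s≤s k<l)
    ; gram = λ u w → trans (cong₂ (λ a b → A u w xor (a ∧ b)) (row-v u) (row-v w))
               (trans (cong (_xor (row F zero u ∧ row F zero w)) (gram F u w))
                      (xor-cancelʳ (row F zero u ∧ row F zero w) (later u w))) }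

-- Along the pivot sequence σ, a pivot factorisation of A is the same thing as
-- a unit Cholesky factorisation of the permuted matrix A_σ: M i k = row k (σ i).
factorisation⇔unitCholesky : ∀ {n} (σ : Permutation′ n) (A : Mat n)
  → PivotFactorisation (σ ⟨$⟩ʳ_) A ⇔ HasUnitCholesky (λ i j → A (σ ⟨$⟩ʳ i) (σ ⟨$⟩ʳ j))
factorisation⇔unitCholesky σ A = mk⇔ to from
  where
  to : PivotFactorisation (σ ⟨$⟩ʳ_) A → HasUnitCholesky (λ i j → A (σ ⟨$⟩ʳ i) (σ ⟨$⟩ʳ j))
  to F = (λ i k → row F k (σ ⟨$⟩ʳ i)) , (echelon F , pivot F) , (λ i j → gram F _ _)
  from : HasUnitCholesky (λ i j → A (σ ⟨$⟩ʳ i) (σ ⟨$⟩ʳ j)) → PivotFactorisation (σ ⟨$⟩ʳ_) A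
  from (M , (lower , diag) , Aσ≐MMᵀ) = record
    { row = λ k u → M (σ ⟨$⟩ˡ u) k
    ; pivot = λ k → trans (cong (λ x → M x k) (inverseˡ σ)) (diag k)
    ; echelon = λ k l k<l → trans (cong (λ x → M x l) (inverseˡ σ)) (lower k l k<l)
    ; gram = λ u w → trans (cong₂ A (sym (inverseʳ σ)) (sym (inverseʳ σ)))
                           (Aσ≐MMᵀ (σ ⟨$⟩ˡ u) (σ ⟨$⟩ˡ w)) }

pressing-criterion : ∀ {n} (g : BiGraph n) → IsSimple g → (σ : Permutation′ n)
  → Successful g (permSeq σ) ⇔ HasUnitCholesky (λ i j → augAdj g (σ ⟨$⟩ʳ i) (σ ⟨$⟩ʳ j))
pressing-criterion {n} g simple σ rewrite map-tabulate id (σ ⟨$⟩ʳ_) =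
  ⇔-trans (successful⇔eliminates g simple (tabulate (σ ⟨$⟩ʳ_)))
  (⇔-trans (mk⇔ (proj₁ ∘ eliminates⇒factorisation (σ ⟨$⟩ʳ_) A (augAdj-symmetric g simple))
                (factorisation⇒eliminates (σ ⟨$⟩ʳ_) A))
           (factorisation⇔unitCholesky σ A))
  where
  A : Mat n
  A = augAdj g

-- From A = LLᵀ: (XᵀX)ᵢⱼ = Σₖ L_{σ i,k} L_{σ j,k} = A_{σ i,σ j} for X = LᵀPᵀ.
permuted-gram : ∀ {n} (A L : Mat n) (σ : Permutation′ n) → A ≐ (L ⊗ (L ᵀ))
  → (λ i j → A (σ ⟨$⟩ʳ i) (σ ⟨$⟩ʳ j)) ≐ ((((L ᵀ) ⊗ (permMat σ ᵀ)) ᵀ) ⊗ ((L ᵀ) ⊗ (permMat σ ᵀ)))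
permuted-gram A L σ A≐LLᵀ i j =
  trans (A≐LLᵀ _ _) (sym (sumF-cong (λ k → cong₂ _∧_ (X-entry k i) (X-entry k j))))
  where
  X-entry : ∀ k j → ((L ᵀ) ⊗ (permMat σ ᵀ)) k j ≡ L (σ ⟨$⟩ʳ j) k
  X-entry = ⊗-permMatᵀ σ (L ᵀ)

proposition5 : (n : ℕ) (g : BiGraph n) → IsSimple g → Successful g (idSeq n)
    → (L : Mat n) → IsLowerTriangular L → IsInvertible L → augAdj g ≐ (L ⊗ (L ᵀ))
    → (σ : Permutation′ n)
    → Successful g (permSeq σ)
      ⇔ (∃[ Q ] ∃[ U ] (IsOrthogonal Q × IsUpperTriangular U
           × ((L ᵀ) ⊗ (permMat σ ᵀ)) ≐ (Q ⊗ U)))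
proposition5 n g simple _ L _ L-invertible A≐LLᵀ σ =
  ⇔-trans (pressing-criterion g simple σ)
  (⇔-trans (unitCholesky-cong (permuted-gram (augAdj g) L σ A≐LLᵀ))
           (⇔-sym (qr⇔unitCholesky X-invertible)))
  where
  X-invertible : IsInvertible ((L ᵀ) ⊗ (permMat σ ᵀ))
  X-invertible = ⊗-invertible (ᵀ-invertible L-invertible) (ᵀ-invertible (permMat-invertible σ))
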